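{- If $H$ is a butterfly minor of a digraph $D$, then $\operatorname{dbw}(H)\leq\operatorname{dbw}(D)$.
   Context: All digraphs are finite; $\vec{xy}$ denotes the directed edge from $x$ to $y$. Contraction: $D/\vec{xy}$ is obtained from $D$ by deleting the edge $\vec{xy}$ and the vertices $x,y$, and adding a new vertex whose in-neighbourhood is $N^-_D(x)\cup N^-_D(y)$ and whose out-neighbourhood is $N^+_D(x)\cup N^+_D(y)$. An edge $\vec{xy}$ is a butterfly edge if $x$ has out-degree $1$ and $y$ has in-degree $1$. A digraph $H$ is a butterfly minor of $D$ if $H$ can be obtained from a subgraph of $D$ by a sequence of contractions of butterfly edges. Directed branch-width: for $B\subseteq E(D)$ let $S_B^V=\{y\in V(D): \exists x,z \text{ with } \vec{xy}\in E(D)\setminus B,\ \vec{yz}\in B\}$ and $f_D(X)=|S_X^V\cup S_{E(D)\setminus X}^V|$. A directed branch decomposition is a pair $(T,\beta)$ with $T$ a tree of maximum degree at most three and $\beta$ a bijection from the leaves of $T$ to $E(D)$. For an edge $xy$ of $T$, with $Y$ the set of leaves in the component of $T-xy$ containing $y$, its order is $f_D(\beta(Y))$. The width is the maximum order of an edge, and $\operatorname{dbw}(D)$ is the minimum width. -}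

module Defs where

open import Data.Nat using (ℕ; zero; suc; _+_; _≤_; _<_)
open import Data.Bool using (Bool; true; false; if_then_else_)
open import Data.Fin using (Fin)
open import Data.Fin.Subset using (Subset; _∈_; ∣_∣)
open import Data.List using (List; []; _∷_; _++_; map; length; allFin)
open import Data.Nat.ListAction using (sum)
open import Data.List.Relation.Unary.Linked using (Linked)
open import Data.List.Relation.Unary.Unique.Propositional using (Unique)
open import Data.Product using (Σ; ∃; _×_; _,_; proj₁; proj₂)
open import Data.Sum using (_⊎_)
open import Data.Empty using (⊥)
open import Relation.Nullary using (¬_)
open import Relation.Binary.PropositionalEquality using (_≡_; _≢_)
open import Relation.Binary.Construct.Closure.ReflexiveTransitive using (Star)
open import Function.Bundles using (_⤖_; Bijection)

countTrue : {t : ℕ} → (Fin t → Bool) → ℕ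
countTrue {t} p = sum (map (λ u → if p u then 1 else 0) (allFin t))

record Digraph (n : ℕ) : Set where
  field
    E        : Fin n → Fin n → Bool          -- E x y = true  iff  xy⃗ ∈ E(D)
    loopless : ∀ v → E v v ≡ false
open Digraph public

Edge : {n : ℕ} → Digraph n → Set
Edge {n} D = Σ (Fin n × Fin n) (λ p → E D (proj₁ p) (proj₂ p) ≡ true)

outdeg : {n : ℕ} → Digraph n → Fin n → ℕ
outdeg D x = countTrue (λ z → E D x z)

indeg : {n : ℕ} → Digraph n → Fin n → ℕ
indeg D y = countTrue (λ w → E D w y)

ButterflyEdge : {n : ℕ} → Digraph n → Fin n → Fin n → Set
ButterflyEdge D x y = (E D x y ≡ true) × (outdeg D x ≡ 1) × (indeg D y ≡ 1)

SubgraphOf : {m n : ℕ} → Digraph m → Digraph n → Set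
SubgraphOf {m} {n} H D =
  Σ (Fin m → Fin n) λ φ →
    (∀ u v → φ u ≡ φ v → u ≡ v) ×
    (∀ u v → E H u v ≡ true → E D (φ u) (φ v) ≡ true)

-- D' is (isomorphic to) D / xy⃗ : σ identifies x and y to the new vertex
-- and is otherwise a bijection; edges of D' are the images of edges of D
-- other than those between x and y (so xy⃗ is deleted, and the new vertex has
-- in-/out-neighbourhood (N⁻(x) ∪ N⁻(y)) ∖ {x,y} resp. (N⁺(x) ∪ N⁺(y)) ∖ {x,y}).
ContractionOf : {n n' : ℕ} → Digraph n → Fin n → Fin n → Digraph n' → Set
ContractionOf {n} {n'} D x y D' =
  Σ (Fin n → Fin n') λ σ →
    (σ x ≡ σ y) ×
    (∀ a → Σ (Fin n) (λ u → σ u ≡ a)) ×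
    (∀ u v → σ u ≡ σ v → u ≡ v ⊎ ((u ≡ x ⊎ u ≡ y) × (v ≡ x ⊎ v ≡ y))) ×
    (∀ a b → (E D' a b ≡ true) →
       (a ≢ b) × Σ (Fin n) (λ u → Σ (Fin n) (λ v → σ u ≡ a × σ v ≡ b × E D u v ≡ true))) ×
    (∀ a b → a ≢ b →
       Σ (Fin n) (λ u → Σ (Fin n) (λ v → σ u ≡ a × σ v ≡ b × E D u v ≡ true)) →
       E D' a b ≡ true)

data ButterflyMinor {n : ℕ} (D : Digraph n) : {m : ℕ} → Digraph m → Set where
  subgraph : ∀ {m} {H : Digraph m} → SubgraphOf H D → ButterflyMinor D H
  contract : ∀ {m m'} {H : Digraph m} {H' : Digraph m'} (x y : Fin m) →
             ButterflyMinor D H → ButterflyEdge H x y →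
             ContractionOf H x y H' → ButterflyMinor D H'

record SubcubicTree : Set where
  field
    size      : ℕ
    adj       : Fin size → Fin size → Bool
    nonempty  : 0 < size
    symmetric : ∀ u v → adj u v ≡ adj v u
    irreflex  : ∀ v → adj v v ≡ false
    connected : ∀ u v → Star (λ a b → adj a b ≡ true) u v
    acyclic   : ¬ (Σ (Fin size) λ v → Σ (List (Fin size)) λ rest →
                    (2 ≤ length rest) × Unique (v ∷ rest) ×
                    Linked (λ a b → adj a b ≡ true) (v ∷ rest ++ v ∷ []))
    maxdeg3   : ∀ v → countTrue (adj v) ≤ 3
open SubcubicTree public

degree : (T : SubcubicTree) → Fin (size T) → ℕ
degree T v = countTrue (adj T v)

Leaf : SubcubicTree → Set
Leaf T = Σ (Fin (size T)) (λ v → degree T v ≤ 1)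

adjMinus : (T : SubcubicTree) → Fin (size T) → Fin (size T) → Fin (size T) → Fin (size T) → Set
adjMinus T x y a b = (adj T a b ≡ true) × ¬ ((a ≡ x × b ≡ y) ⊎ (a ≡ y × b ≡ x))

InComp : (T : SubcubicTree) → Fin (size T) → Fin (size T) → Fin (size T) → Set
InComp T x y z = Star (adjMinus T x y) y z

SV : {n : ℕ} (D : Digraph n) → (Edge D → Set) → Fin n → Set
SV {n} D B y =
  Σ (Fin n) λ x → Σ (Fin n) λ z →
    Σ (E D x y ≡ true) λ exy → Σ (E D y z ≡ true) λ eyz →
      ¬ B ((x , y) , exy) × B ((y , z) , eyz)

fAtMost : {n : ℕ} (D : Digraph n) → (Edge D → Set) → ℕ → Set
fAtMost {n} D X k =
  Σ (Subset n) λ P →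
    (∀ y → SV D X y ⊎ SV D (λ e → ¬ X e) y → y ∈ P) × (∣ P ∣ ≤ k)

record BranchDecomposition {n : ℕ} (D : Digraph n) : Set where
  field
    tree : SubcubicTree
    β    : Leaf tree ⤖ Edge D
open BranchDecomposition public

βComp : {n : ℕ} {D : Digraph n} (dec : BranchDecomposition D) →
        Fin (size (tree dec)) → Fin (size (tree dec)) → Edge D → Set
βComp dec x y e =
  Σ (Leaf (tree dec)) λ l → InComp (tree dec) x y (proj₁ l) × (Bijection.to (β dec) l ≡ e)

WidthAtMost : {n : ℕ} {D : Digraph n} → BranchDecomposition D → ℕ → Set
WidthAtMost {D = D} dec k =
  ∀ x y → adj (tree dec) x y ≡ true → fAtMost D (βComp dec x y) k

-- dbw(D) ≤ k  (convention: a digraph without edges has dbw 0)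
DbwAtMost : {n : ℕ} → Digraph n → ℕ → Set
DbwAtMost D k = ¬ Edge D ⊎ Σ (BranchDecomposition D) (λ dec → WidthAtMost dec k)

-- A subgraph or a butterfly contraction H of D comes with an injection ψ : E(H) → E(D) that
-- transfers boundaries: every vertex set P of D has a counterpart P′ in H with |P′| ≤ |P| such
-- that S^V_{ψ⁻¹(B)} ⊆ P′ whenever S^V_B ⊆ P. For a subgraph P′ is the preimage of P; for the
-- contraction of xy it is the image of P, and the only new boundary vertex can arise at the
-- contracted vertex from an edge into x followed by an edge out of y, where the edge xy itself
-- places x or y in S^V_B (the opposite order is excluded as y has in-degree 1).
-- Given a branch decomposition of D, repeatedly delete the leaves not labelled by ψ-images. The
-- remaining subcubic tree has exactly the edges of H at its leaves, and its edge separations are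
-- traces of those of the original tree, so every order can only drop.

module Submission where

open import Defs
open import Axiom.UniquenessOfIdentityProofs using (module Decidable⇒UIP)
open import Data.Bool using (Bool; true; false; if_then_else_)
import Data.Bool as Bool
open import Data.Empty using (⊥; ⊥-elim)
open import Data.Fin using (Fin; zero; suc; _≟_; punchIn; punchOut)
open import Data.Fin.Properties
  using ( nonZeroIndex; suc-injective; 0≢1+n; any?
        ; punchIn-injective; punchIn-punchOut; punchOut-punchIn; punchOut-cong )
open import Data.Fin.Subset using (Subset; _∈_; ∣_∣; _-_; inside; outside)
open import Data.Fin.Subset.Properties using (x∈p∧x≢y⇒x∈p-y; x∈p⇒∣p-x∣<∣p∣; _∈?_)
open import Data.List using (List; []; _∷_; _++_; _∷ʳ_; length)
import Data.List as List
open import Data.List.Membership.Propositional.Properties using (∈-∃++)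
open import Data.List.Properties using (map-tabulate; map-++; length-map; ++-assoc)
open import Data.List.Relation.Binary.Permutation.Propositional using (↭-sym; ↭⇒↭ₛ)
open import Data.List.Relation.Binary.Permutation.Propositional.Properties using (∷↭∷ʳ)
open import Data.List.Relation.Unary.All using ([]; _∷_)
open import Data.List.Relation.Unary.All.Properties using (¬Any⇒All¬) renaming (++⁺ to All-++⁺)
open import Data.List.Relation.Unary.AllPairs using ([]; _∷_)
open import Data.List.Relation.Unary.Linked using (Linked; [-]; _∷_)
import Data.List.Relation.Unary.Linked as Linked
import Data.List.Relation.Unary.Linked.Properties as Linkedₚ
open import Data.List.Relation.Unary.Unique.Propositional using (Unique)
import Data.List.Relation.Unary.Unique.Propositional.Properties as Uniqueₚ
open import Data.Nat using (ℕ; zero; suc; _≤_; _<_; z≤n; s≤s; _≤?_; >-nonZero⁻¹)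
open import Data.Nat.ListAction using (sum)
open import Data.Nat.Properties
  using (≤-trans; ≤-<-trans; <-≤-trans; <-irrefl; ≤-irrelevant; ≤-reflexive)
open import Data.Product using (Σ; ∃; _×_; _,_; proj₁; proj₂)
import Data.Product as Product
open import Data.Sum using (_⊎_; inj₁; inj₂)
import Data.Sum as Sum
open import Data.Unit using (tt)
open import Data.Vec using ([]; _∷_; here; there; tabulate)
open import Data.Vec.Properties using (lookup⇒[]=; []=⇒lookup; lookup∘tabulate)
open import Function using (_∘_; id)
open import Function.Bundles using (Bijection; mk⤖)
open import Relation.Binary.Construct.Closure.ReflexiveTransitive using (Star; ε; _◅_; _◅◅_)
import Relation.Binary.Construct.Closure.ReflexiveTransitive as Star
open import Relation.Binary.Definitions using (DecidableEquality)
open import Relation.Binary.PropositionalEquality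
open import Relation.Nullary using (¬_; Dec; yes; no; does; contradiction; contraposition)
open import Relation.Nullary.Decidable using (map′; dec-true; _×-dec_; _⊎-dec_; ¬?; decidable-stable)
open import Relation.Unary using (Pred; Decidable)

∈-tabulate⁺ : ∀ {n} (p : Fin n → Bool) {i} → p i ≡ true → i ∈ tabulate p
∈-tabulate⁺ p {i} pi = lookup⇒[]= i (tabulate p) (trans (lookup∘tabulate p i) pi)

∈-tabulate⁻ : ∀ {n} (p : Fin n → Bool) {i} → i ∈ tabulate p → p i ≡ true
∈-tabulate⁻ p {i} i∈ = trans (sym (lookup∘tabulate p i)) ([]=⇒lookup i∈)

countTrue≡∣tabulate∣ : ∀ {n} (p : Fin n → Bool) → countTrue p ≡ ∣ tabulate p ∣
countTrue≡∣tabulate∣ p = trans (cong sum (map-tabulate id (λ u → if p u then 1 else 0))) (sum-tabulate p)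
  where
  sum-tabulate : ∀ {n} (p : Fin n → Bool) →
                 sum (List.tabulate (λ i → if p i then 1 else 0)) ≡ ∣ tabulate p ∣
  sum-tabulate {zero} p = refl
  sum-tabulate {suc n} p with p zero
  ... | true  = cong suc (sum-tabulate (p ∘ suc))
  ... | false = sum-tabulate (p ∘ suc)

injection⇒∣p∣≤∣q∣ : ∀ {m n} {p : Subset m} {q : Subset n} (g : ∀ i → i ∈ p → Fin n) →
                    (∀ {i} (i∈p : i ∈ p) → g i i∈p ∈ q) →
                    (∀ {i j} (i∈p : i ∈ p) (j∈p : j ∈ p) → g i i∈p ≡ g j j∈p → i ≡ j) →
                    ∣ p ∣ ≤ ∣ q ∣
injection⇒∣p∣≤∣q∣ {p = []} g g∈q g-inj = z≤n
injection⇒∣p∣≤∣q∣ {p = outside ∷ p} g g∈q g-inj =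
  injection⇒∣p∣≤∣q∣ (λ i → g (suc i) ∘ there) (g∈q ∘ there)
    (λ i∈p j∈p → suc-injective ∘ g-inj (there i∈p) (there j∈p))
injection⇒∣p∣≤∣q∣ {p = inside ∷ p} {q} g g∈q g-inj =
  ≤-<-trans ∣p∣≤∣q-g₀∣ (x∈p⇒∣p-x∣<∣p∣ (g∈q here))
  where
  g₀ : Fin _
  g₀ = g zero here
  ∣p∣≤∣q-g₀∣ : ∣ p ∣ ≤ ∣ q - g₀ ∣
  ∣p∣≤∣q-g₀∣ = injection⇒∣p∣≤∣q∣ (λ i → g (suc i) ∘ there)
    (λ i∈p → x∈p∧x≢y⇒x∈p-y (g∈q (there i∈p)) (0≢1+n ∘ sym ∘ g-inj (there i∈p) here))
    (λ i∈p j∈p → suc-injective ∘ g-inj (there i∈p) (there j∈p))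

countTrue-≤-injection : ∀ {m n} {p : Fin m → Bool} {q : Fin n → Bool} (f : Fin m → Fin n) →
                        (∀ {i} → p i ≡ true → q (f i) ≡ true) →
                        (∀ {i j} → f i ≡ f j → i ≡ j) → countTrue p ≤ countTrue q
countTrue-≤-injection {p = p} {q} f pq f-inj =
  subst₂ _≤_ (sym (countTrue≡∣tabulate∣ p)) (sym (countTrue≡∣tabulate∣ q))
    (injection⇒∣p∣≤∣q∣ (λ i _ → f i) (∈-tabulate⁺ q ∘ pq ∘ ∈-tabulate⁻ p) (λ _ _ → f-inj))

countTrue≤1⇒unique : ∀ {n} (p : Fin n → Bool) → countTrue p ≤ 1 →
                     ∀ {i j} → p i ≡ true → p j ≡ true → i ≡ j
countTrue≤1⇒unique p count≤1 {i} {j} pi pj with i ≟ j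
... | yes i≡j = i≡j
... | no i≢j  =
  contradiction (<-≤-trans 1<∣P∣ (subst (_≤ 1) (countTrue≡∣tabulate∣ p) count≤1)) (<-irrefl refl)
  where
  P : Subset _
  P = tabulate p
  1<∣P∣ : 1 < ∣ P ∣
  1<∣P∣ = ≤-<-trans (≤-<-trans z≤n (x∈p⇒∣p-x∣<∣p∣ j∈P-i)) (x∈p⇒∣p-x∣<∣p∣ (∈-tabulate⁺ p pi))
    where
    j∈P-i : j ∈ P - i
    j∈P-i = x∈p∧x≢y⇒x∈p-y (∈-tabulate⁺ p pj) (i≢j ∘ sym)

fromDec : ∀ {n ℓ} {P : Pred (Fin n) ℓ} → Decidable P → Subset n
fromDec P? = tabulate (does ∘ P?)

module _ {n ℓ} {P : Pred (Fin n) ℓ} (P? : Decidable P) where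

  ∈-fromDec⁺ : ∀ {i} → P i → i ∈ fromDec P?
  ∈-fromDec⁺ {i} Pi = ∈-tabulate⁺ (does ∘ P?) (dec-true (P? i) Pi)

  ∈-fromDec⁻ : ∀ {i} → i ∈ fromDec P? → P i
  ∈-fromDec⁻ {i} i∈ with P? i | ∈-tabulate⁻ (does ∘ P?) i∈
  ... | yes Pi | _ = Pi
  ... | no _   | ()

preimage : ∀ {m n} → (Fin m → Fin n) → Subset n → Subset m
preimage f P = fromDec (λ i → f i ∈? P)

∣preimage∣≤∣p∣ : ∀ {m n} (f : Fin m → Fin n) → (∀ {i j} → f i ≡ f j → i ≡ j) →
                 (P : Subset n) → ∣ preimage f P ∣ ≤ ∣ P ∣
∣preimage∣≤∣p∣ f f-inj P =
  injection⇒∣p∣≤∣q∣ (λ i _ → f i) (∈-fromDec⁻ (λ i → f i ∈? P)) (λ _ _ → f-inj)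

∈-preimage⁺ : ∀ {m n} (f : Fin m → Fin n) {P : Subset n} {i} → f i ∈ P → i ∈ preimage f P
∈-preimage⁺ f {P} = ∈-fromDec⁺ (λ i → f i ∈? P)

image : ∀ {m n} → (Fin m → Fin n) → Subset m → Subset n
image f P = fromDec (λ a → any? (λ u → (f u ≟ a) ×-dec (u ∈? P)))

∈-image⁺ : ∀ {m n} (f : Fin m → Fin n) (P : Subset m) {u} → u ∈ P → f u ∈ image f P
∈-image⁺ f P {u} u∈P =
  ∈-fromDec⁺ (λ a → any? (λ u → (f u ≟ a) ×-dec (u ∈? P))) (u , refl , u∈P)

∣image∣≤∣p∣ : ∀ {m n} (f : Fin m → Fin n) (P : Subset m) → ∣ image f P ∣ ≤ ∣ P ∣
∣image∣≤∣p∣ f P = injection⇒∣p∣≤∣q∣ (λ _ → proj₁ ∘ witness) (proj₂ ∘ proj₂ ∘ witness)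
  (λ a∈ b∈ eq → trans (sym (f-witness a∈)) (trans (cong f eq) (f-witness b∈)))
  where
  witness : ∀ {a} → a ∈ image f P → ∃ λ u → f u ≡ a × u ∈ P
  witness = ∈-fromDec⁻ (λ a → any? (λ u → (f u ≟ a) ×-dec (u ∈? P)))

  f-witness : ∀ {a} (a∈ : a ∈ image f P) → f (proj₁ (witness a∈)) ≡ a
  f-witness = proj₁ ∘ proj₂ ∘ witness

Adjacent : ∀ {n} → (Fin n → Fin n → Bool) → Fin n → Fin n → Set
Adjacent A a b = A a b ≡ true

Cycle : ∀ {n} → (Fin n → Fin n → Bool) → Set
Cycle {n} A = Σ (Fin n) λ v → Σ (List (Fin n)) λ rest →
  (2 ≤ length rest) × Unique (v ∷ rest) × Linked (Adjacent A) (v ∷ rest ++ v ∷ [])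

record IsSubcubicTree {n : ℕ} (A : Fin n → Fin n → Bool) : Set where
  field
    nonempty  : 0 < n
    symmetric : ∀ u v → A u v ≡ A v u
    irreflex  : ∀ v → A v v ≡ false
    connected : ∀ u v → Star (Adjacent A) u v
    acyclic   : ¬ Cycle A
    maxdeg3   : ∀ v → countTrue (A v) ≤ 3

isSubcubicTree : (T : SubcubicTree) → IsSubcubicTree (adj T)
isSubcubicTree T = record { SubcubicTree T hiding (size; adj) }

toSubcubicTree : ∀ {n} {A : Fin n → Fin n → Bool} → IsSubcubicTree A → SubcubicTree
toSubcubicTree {n} {A} t = record { size = n ; adj = A ; IsSubcubicTree t }

module _ {k} {A : Fin (suc k) → Fin (suc k) → Bool} (t : IsSubcubicTree A)
         (a : Fin (suc k)) (a-leaf : countTrue (A a) ≤ 1) where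

  A∖a : Fin k → Fin k → Bool
  A∖a i j = A (punchIn a i) (punchIn a j)

  private
    module t = IsSubcubicTree t

    -- A walk entering the leaf a must leave it straight back to where it came from.
    walk-avoiding : ∀ {u w} (a≢u : a ≢ u) (a≢w : a ≢ w) → Star (Adjacent A) u w →
                    Star (Adjacent A∖a) (punchOut a≢u) (punchOut a≢w)
    walk-avoiding a≢u a≢w ε = subst (Star _ _) (punchOut-cong a refl) ε
    walk-avoiding a≢u a≢w (_◅_ {j = c} uc rest) with a ≟ c
    ... | no a≢c = step ◅ walk-avoiding a≢c a≢w rest
      where
      step : Adjacent A∖a (punchOut a≢u) (punchOut a≢c)
      step rewrite punchIn-punchOut a≢u | punchIn-punchOut a≢c = uc
    ... | yes refl with rest
    ...   | ε = contradiction refl a≢w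
    ...   | au′ ◅ rest′ with countTrue≤1⇒unique (A a) a-leaf (trans (t.symmetric a _) uc) au′
    ...     | refl = walk-avoiding a≢u a≢w rest′

  deleteLeaf : 0 < k → IsSubcubicTree A∖a
  deleteLeaf 0<k = record
    { nonempty  = 0<k
    ; symmetric = λ i j → t.symmetric (punchIn a i) (punchIn a j)
    ; irreflex  = t.irreflex ∘ punchIn a
    ; connected = λ i j → subst₂ (Star _) (punchOut-punchIn a) (punchOut-punchIn a)
                    (walk-avoiding _ _ (t.connected (punchIn a i) (punchIn a j)))
    ; acyclic   = λ { (v , rest , 2≤len , unique , linked) → t.acyclic
                    ( punchIn a v , List.map (punchIn a) rest
                    , subst (2 ≤_) (sym (length-map (punchIn a) rest)) 2≤len
                    , Uniqueₚ.map⁺ (punchIn-injective a _ _) unique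
                    , subst (Linked _) (cong (punchIn a v ∷_) (map-++ (punchIn a) rest (v ∷ [])))
                        (Linkedₚ.map⁺ linked) ) }
    ; maxdeg3   = λ i → ≤-trans (countTrue-≤-injection (punchIn a) id (punchIn-injective a _ _))
                                (t.maxdeg3 (punchIn a i))
    }

record Pruning {n} (A : Fin n → Fin n → Bool) (Keep : Fin n → Set) : Set where
  field
    {k}         : ℕ
    ι           : Fin k → Fin n
    ι-injective : ∀ {a b} → ι a ≡ ι b → a ≡ b
    isTree      : IsSubcubicTree (λ a b → A (ι a) (ι b))
    kept⇒ι      : ∀ {v} → Keep v → ∃ λ a → ι a ≡ v
    leaf⇒kept   : ∀ {a} → countTrue (λ b → A (ι a) (ι b)) ≤ 1 → Keep (ι a)

  degree-ι : ∀ a → countTrue (λ b → A (ι a) (ι b)) ≤ countTrue (A (ι a))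
  degree-ι a = countTrue-≤-injection ι id ι-injective

prune : ∀ {n} {A : Fin n → Fin n → Bool} → IsSubcubicTree A →
        {Keep : Fin n → Set} → Decidable Keep → ∃ Keep → Pruning A Keep
prune {zero} _ _ (() , _)
prune {suc k} {A} t {Keep} keep? (v , keep-v)
  with any? (λ a → (countTrue (A a) ≤? 1) ×-dec ¬? (keep? a))
... | no noDisposableLeaf = record
  { ι           = id
  ; ι-injective = id
  ; isTree      = t
  ; kept⇒ι      = λ {v} _ → v , refl
  ; leaf⇒kept   = λ {a} a-leaf →
                    decidable-stable (keep? a) (λ ¬keep-a → noDisposableLeaf (a , a-leaf , ¬keep-a))
  }
... | yes (a , a-leaf , ¬keep-a) = record
  { ι           = punchIn a ∘ P.ι
  ; ι-injective = P.ι-injective ∘ punchIn-injective a _ _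
  ; isTree      = P.isTree
  ; kept⇒ι      = kept⇒ι
  ; leaf⇒kept   = P.leaf⇒kept
  }
  where
  a≢kept : ∀ {u} → Keep u → a ≢ u
  a≢kept keep-u refl = ¬keep-a keep-u

  punchOut-kept : ∀ {u} (keep-u : Keep u) → Keep (punchIn a (punchOut (a≢kept keep-u)))
  punchOut-kept keep-u = subst Keep (sym (punchIn-punchOut (a≢kept keep-u))) keep-u

  P : Pruning _ (Keep ∘ punchIn a)
  P = prune (deleteLeaf t a a-leaf (>-nonZero⁻¹ k {{nonZeroIndex (punchOut (a≢kept keep-v))}}))
            (keep? ∘ punchIn a) (_ , punchOut-kept keep-v)
  module P = Pruning P

  kept⇒ι : ∀ {u} → Keep u → ∃ λ b → punchIn a (P.ι b) ≡ u
  kept⇒ι keep-u with P.kept⇒ι (punchOut-kept keep-u)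
  ... | b , ιb≡ = b , trans (cong (punchIn a) ιb≡) (punchIn-punchOut (a≢kept keep-u))

module _ {A : Set} (_≟ᴬ_ : DecidableEquality A) {R : A → A → Set} where

  open import Data.List.Membership.DecPropositional _≟ᴬ_ using () renaming (_∈?_ to _∈ᴸ?_)

  SimplePath : A → A → Set
  SimplePath a b =
    a ≡ b ⊎ Σ (List A) λ ws → Unique (a ∷ ws ++ b ∷ []) × Linked R (a ∷ ws ++ b ∷ [])

  private
    Unique-++⁻ʳ : ∀ (xs : List A) {ys} → Unique (xs ++ ys) → Unique ys
    Unique-++⁻ʳ []       unique       = unique
    Unique-++⁻ʳ (x ∷ xs) (_ ∷ unique) = Unique-++⁻ʳ xs unique

    Linked-++⁻ʳ : ∀ (xs : List A) {ys} → Linked R (xs ++ ys) → Linked R ys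
    Linked-++⁻ʳ []       linked = linked
    Linked-++⁻ʳ (x ∷ xs) linked = Linked-++⁻ʳ xs (Linked.tail linked)

  -- A walk that revisits its first vertex is cut back to its last visit there.
  simplePath : ∀ {a b} → Star R a b → SimplePath a b
  simplePath ε = inj₁ refl
  simplePath {a} {b} (_◅_ {j = c} ac rest) with a ≟ᴬ b | simplePath rest
  ... | yes a≡b | _ = inj₁ a≡b
  ... | no a≢b | inj₁ refl = inj₂ ([] , (a≢b ∷ []) ∷ [] ∷ [] , ac ∷ [-])
  ... | no a≢b | inj₂ (ws , unique , linked) with a ∈ᴸ? (c ∷ ws)
  ...   | no a∉ =
    inj₂ (c ∷ ws , All-++⁺ (¬Any⇒All¬ (c ∷ ws) a∉) (a≢b ∷ []) ∷ unique , ac ∷ linked)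
  ...   | yes a∈ with ∈-∃++ a∈
  ...     | pre , post , c∷ws≡ =
    inj₂ ( post
         , Unique-++⁻ʳ pre (subst Unique path≡ unique)
         , Linked-++⁻ʳ pre (subst (Linked R) path≡ linked) )
    where
    path≡ : c ∷ ws ++ b ∷ [] ≡ pre ++ a ∷ post ++ b ∷ []
    path≡ = trans (cong (_++ b ∷ []) c∷ws≡) (++-assoc pre (a ∷ post) (b ∷ []))

module _ (T : SubcubicTree) where

  open import Data.List.Relation.Binary.Permutation.Setoid.Properties (setoid (Fin (size T)))
    using (Unique-resp-↭)

  private
    adjMinus-sym : ∀ {x y u v} → adjMinus T x y u v → adjMinus T x y v u
    adjMinus-sym {u = u} {v} (uv , not-xy) =
      trans (symmetric T v u) uv , not-xy ∘ Sum.swap ∘ Sum.map Product.swap Product.swap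

    adjMinus-swap : ∀ {x y u v} → adjMinus T x y u v → adjMinus T y x u v
    adjMinus-swap (uv , not-xy) = uv , not-xy ∘ Sum.swap

    lastCrossing : ∀ x y {u z} → Star (Adjacent (adj T)) u z →
                   Star (adjMinus T x y) u z ⊎ Star (adjMinus T x y) x z ⊎ Star (adjMinus T x y) y z
    lastCrossing x y ε = inj₁ ε
    lastCrossing x y {u} (_◅_ {j = w} uw rest) with lastCrossing x y rest
    ... | inj₂ after = inj₂ after
    ... | inj₁ w⇝z with ((u ≟ x) ×-dec (w ≟ y)) ⊎-dec ((u ≟ y) ×-dec (w ≟ x))
    ...   | no not-xy               = inj₁ ((uw , not-xy) ◅ w⇝z)
    ...   | yes (inj₁ (_ , refl)) = inj₂ (inj₂ w⇝z)
    ...   | yes (inj₂ (_ , refl)) = inj₂ (inj₁ w⇝z)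

  InComp-cover : ∀ x y z → InComp T x y z ⊎ InComp T y x z
  InComp-cover x y z with lastCrossing x y (connected T y z)
  ... | inj₁ y⇝z        = inj₁ y⇝z
  ... | inj₂ (inj₁ x⇝z) = inj₂ (Star.map adjMinus-swap x⇝z)
  ... | inj₂ (inj₂ y⇝z) = inj₁ y⇝z

  -- A path from y to x in T − xy closes up with the edge xy to a cycle.
  InComp-disjoint : ∀ {x y z} → adj T x y ≡ true → InComp T x y z → InComp T y x z → ⊥
  InComp-disjoint {x} {y} xy y⇝z x⇝z
    with simplePath _≟_ (y⇝z ◅◅ Star.reverse adjMinus-sym (Star.map adjMinus-swap x⇝z))
  ... | inj₁ refl = contradiction (trans (sym xy) (irreflex T x)) λ ()
  ... | inj₂ ([] , _ , (_ , not-xy) ∷ _) = not-xy (inj₂ (refl , refl))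
  ... | inj₂ (w ∷ ws , unique , linked) =
    acyclic T (x , y ∷ w ∷ ws , s≤s (s≤s z≤n) , rotate unique , xy ∷ Linked.map proj₁ linked)
    where
    rotate : Unique ((y ∷ w ∷ ws) ∷ʳ x) → Unique (x ∷ y ∷ w ∷ ws)
    rotate = Unique-resp-↭ (↭⇒↭ₛ (↭-sym (∷↭∷ʳ x (y ∷ w ∷ ws))))

module _ (T T′ : SubcubicTree) (ι : Fin (size T′) → Fin (size T))
         (ι-injective : ∀ {a b} → ι a ≡ ι b → a ≡ b)
         (adj-ι : ∀ a b → adj T′ a b ≡ adj T (ι a) (ι b)) where

  InComp-map : ∀ {a b l} → InComp T′ a b l → InComp T (ι a) (ι b) (ι l)
  InComp-map = Star.gmap ι λ (uv , not-ab) →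
    trans (sym (adj-ι _ _)) uv , not-ab ∘ Sum.map (Product.map ι-injective ι-injective)
                                                 (Product.map ι-injective ι-injective)

  InComp-reflect : ∀ {a b l} → adj T′ a b ≡ true → InComp T (ι a) (ι b) (ι l) → InComp T′ a b l
  InComp-reflect {a} {b} {l} ab ιb⇝ιl with InComp-cover T′ a b l
  ... | inj₁ b⇝l = b⇝l
  ... | inj₂ a⇝l = ⊥-elim (InComp-disjoint T (trans (sym (adj-ι a b)) ab) ιb⇝ιl (InComp-map a⇝l))

module BoolUIP = Decidable⇒UIP Bool._≟_

module _ {n} (D : Digraph n) where

  Edge-≡ : ∀ {e e′ : Edge D} → proj₁ e ≡ proj₁ e′ → e ≡ e′
  Edge-≡ {_ , p} {_ , q} refl = cong (_ ,_) (BoolUIP.≡-irrelevant p q)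

  anyEdge? : {Q : Edge D → Set} → Decidable Q → Dec (Σ (Edge D) Q)
  anyEdge? {Q} Q? = map′ (λ (a , b , p , q) → ((a , b) , p) , q) (λ (((a , b) , p) , q) → a , b , p , q)
                         (any? λ a → any? λ b → edgeWith? a b)
    where
    edgeWith? : ∀ a b → Dec (Σ (E D a b ≡ true) λ p → Q ((a , b) , p))
    edgeWith? a b with E D a b Bool.≟ true
    ... | no ¬p = no (¬p ∘ proj₁)
    ... | yes p = map′ (p ,_)
                       (λ (p′ , q) → subst (λ r → Q ((a , b) , r)) (BoolUIP.≡-irrelevant p′ p) q)
                       (Q? ((a , b) , p))

  edge? : Dec (Edge D)
  edge? = map′ proj₁ (_, tt) (anyEdge? (λ _ → yes tt))

  module _ {X Y : Edge D → Set} (X⇒Y : ∀ e → X e → Y e) (Y⇒X : ∀ e → Y e → X e) where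

    SV-resp : ∀ {v} → SV D X v → SV D Y v
    SV-resp (x , z , xv , vz , ¬Xxv , Xvz) = x , z , xv , vz , ¬Xxv ∘ Y⇒X _ , X⇒Y _ Xvz

  fAtMost-resp : ∀ {X Y : Edge D → Set} {k} → (∀ e → X e → Y e) → (∀ e → Y e → X e) →
                 fAtMost D X k → fAtMost D Y k
  fAtMost-resp X⇒Y Y⇒X (P , cover , ∣P∣≤k) =
    P , (λ v → cover v ∘ Sum.map (SV-resp Y⇒X X⇒Y)
                                  (SV-resp (λ e → contraposition (X⇒Y e)) (λ e → contraposition (Y⇒X e))))
      , ∣P∣≤k

BoundaryTransfer : ∀ {n m} (D : Digraph n) (H : Digraph m) → (Edge H → Edge D) → Set₁
BoundaryTransfer {n} {m} D H ψ =
  ∀ (P : Subset n) → ∃ λ (P′ : Subset m) → ∣ P′ ∣ ≤ ∣ P ∣ ×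
    (∀ (B : Edge D → Set) → (∀ v → SV D B v → v ∈ P) → ∀ v → SV H (B ∘ ψ) v → v ∈ P′)

fAtMost-pullback : ∀ {n m} {D : Digraph n} {H : Digraph m} {ψ : Edge H → Edge D} →
                   BoundaryTransfer D H ψ → ∀ {X k} → fAtMost D X k → fAtMost H (X ∘ ψ) k
fAtMost-pullback transfer {X} (P , cover , ∣P∣≤k) with transfer P
... | P′ , ∣P′∣≤∣P∣ , covers =
  P′ , (λ v → Sum.[ covers X (λ u → cover u ∘ inj₁) v , covers (¬_ ∘ X) (λ u → cover u ∘ inj₂) v ])
     , ≤-trans ∣P′∣≤∣P∣ ∣P∣≤k

Leaf-≡ : ∀ {T : SubcubicTree} {l l′ : Leaf T} → proj₁ l ≡ proj₁ l′ → l ≡ l′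
Leaf-≡ {l = _ , p} {_ , q} refl = cong (_ ,_) (≤-irrelevant p q)

module Restriction {n m} {D : Digraph n} {H : Digraph m} {ψ : Edge H → Edge D}
                   (ψ-injective : ∀ {e e′} → ψ e ≡ ψ e′ → e ≡ e′)
                   (dec : BranchDecomposition D) (e₀ : Edge H) where

  private
    T : SubcubicTree
    T = tree dec

    β̂ : Leaf T → Edge D
    β̂ = Bijection.to (β dec)

    leafOf : Edge D → Leaf T
    leafOf d = proj₁ (Bijection.surjective (β dec) d)

    β-leafOf : ∀ d → β̂ (leafOf d) ≡ d
    β-leafOf d = proj₂ (Bijection.surjective (β dec) d) refl

    Keep : Fin (size T) → Set
    Keep v = Σ (Edge H) λ e → proj₁ (leafOf (ψ e)) ≡ v

    pruning : Pruning (adj T) Keep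
    pruning = prune (isSubcubicTree T) (λ v → anyEdge? H (λ e → proj₁ (leafOf (ψ e)) ≟ v))
                    (_ , e₀ , refl)

  open Pruning pruning

  private
    T′ : SubcubicTree
    T′ = toSubcubicTree isTree

    edgeAt : Leaf T′ → Edge H
    edgeAt (a , a-leaf) = proj₁ (leaf⇒kept a-leaf)

    leafOf-edgeAt : ∀ l → proj₁ (leafOf (ψ (edgeAt l))) ≡ ι (proj₁ l)
    leafOf-edgeAt (a , a-leaf) = proj₂ (leaf⇒kept a-leaf)

    leafAt : Edge H → Leaf T′
    leafAt e = let a , ιa≡ = kept⇒ι (e , refl) in
      a , ≤-trans (degree-ι a) (subst (λ v → degree T v ≤ 1) (sym ιa≡) (proj₂ (leafOf (ψ e))))

    ι-leafAt : ∀ e → ι (proj₁ (leafAt e)) ≡ proj₁ (leafOf (ψ e))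
    ι-leafAt e = proj₂ (kept⇒ι (e , refl))

    edgeAt-leafAt : ∀ e → edgeAt (leafAt e) ≡ e
    edgeAt-leafAt e = ψ-injective (begin
      ψ (edgeAt (leafAt e))              ≡⟨ β-leafOf _ ⟨
      β̂ (leafOf (ψ (edgeAt (leafAt e)))) ≡⟨ cong β̂ (Leaf-≡ {T} same-vertex) ⟩
      β̂ (leafOf (ψ e))                   ≡⟨ β-leafOf (ψ e) ⟩
      ψ e                                ∎)
      where
      open ≡-Reasoning
      same-vertex : proj₁ (leafOf (ψ (edgeAt (leafAt e)))) ≡ proj₁ (leafOf (ψ e))
      same-vertex = trans (leafOf-edgeAt (leafAt e)) (ι-leafAt e)

    edgeAt-injective : ∀ {l l′} → edgeAt l ≡ edgeAt l′ → l ≡ l′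
    edgeAt-injective {l} {l′} eq = Leaf-≡ {T′} (ι-injective (begin
      ι (proj₁ l)                      ≡⟨ leafOf-edgeAt l ⟨
      proj₁ (leafOf (ψ (edgeAt l)))    ≡⟨ cong (λ e → proj₁ (leafOf (ψ e))) eq ⟩
      proj₁ (leafOf (ψ (edgeAt l′)))   ≡⟨ leafOf-edgeAt l′ ⟩
      ι (proj₁ l′)                     ∎))
      where open ≡-Reasoning

  restriction : BranchDecomposition H
  restriction = record
    { tree = T′
    ; β    = mk⤖ (edgeAt-injective , λ e → leafAt e , λ { refl → edgeAt-leafAt e })
    }

  private
    βComp-restriction⇒ : ∀ a b e → βComp restriction a b e → βComp dec (ι a) (ι b) (ψ e)
    βComp-restriction⇒ a b e (l , b⇝l , refl) =
      leafOf (ψ (edgeAt l)) ,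
      subst (InComp T (ι a) (ι b)) (sym (leafOf-edgeAt l))
            (InComp-map T T′ ι ι-injective (λ _ _ → refl) b⇝l) ,
      β-leafOf _

    βComp-restriction⇐ : ∀ a b → adj T′ a b ≡ true →
                         ∀ e → βComp dec (ι a) (ι b) (ψ e) → βComp restriction a b e
    βComp-restriction⇐ a b ab e (l , ιb⇝l , βl≡ψe) =
      leafAt e ,
      InComp-reflect T T′ ι ι-injective (λ _ _ → refl) ab (subst (InComp T (ι a) (ι b)) l≡ ιb⇝l) ,
      edgeAt-leafAt e
      where
      l≡ : proj₁ l ≡ ι (proj₁ (leafAt e))
      l≡ = trans (cong proj₁ (Bijection.injective (β dec) (trans βl≡ψe (sym (β-leafOf (ψ e))))))
                 (sym (ι-leafAt e))

  restriction-width : ∀ {k} → BoundaryTransfer D H ψ → WidthAtMost dec k → WidthAtMost restriction k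
  restriction-width transfer width a b ab =
    fAtMost-resp H (βComp-restriction⇐ a b ab) (βComp-restriction⇒ a b)
      (fAtMost-pullback {D = D} {H = H} {ψ = ψ} transfer (width (ι a) (ι b) ab))

dbw-pullback : ∀ {n m} {D : Digraph n} {H : Digraph m} (ψ : Edge H → Edge D) →
               (∀ {e e′} → ψ e ≡ ψ e′ → e ≡ e′) → BoundaryTransfer D H ψ →
               ∀ k → DbwAtMost D k → DbwAtMost H k
dbw-pullback ψ _ _ k (inj₁ ¬edge) = inj₁ (¬edge ∘ ψ)
dbw-pullback {H = H} ψ ψ-injective transfer k (inj₂ (dec , width)) with edge? H
... | no ¬edge = inj₁ ¬edge
... | yes e₀   = inj₂ (restriction , restriction-width transfer width)
  where open Restriction ψ-injective dec e₀

module Subgraph {n m} (D : Digraph n) (H : Digraph m) (sub : SubgraphOf H D) where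

  private
    φ : Fin m → Fin n
    φ = proj₁ sub

    φ-injective : ∀ {u v} → φ u ≡ φ v → u ≡ v
    φ-injective = proj₁ (proj₂ sub) _ _

    φ-edge : ∀ u v → E H u v ≡ true → E D (φ u) (φ v) ≡ true
    φ-edge = proj₂ (proj₂ sub)

  embedEdge : Edge H → Edge D
  embedEdge ((u , v) , uv) = (φ u , φ v) , φ-edge u v uv

  embedEdge-injective : ∀ {e e′} → embedEdge e ≡ embedEdge e′ → e ≡ e′
  embedEdge-injective eq = Edge-≡ H (cong₂ _,_ (φ-injective (cong (proj₁ ∘ proj₁) eq))
                                                (φ-injective (cong (proj₂ ∘ proj₁) eq)))

  boundaryTransfer : BoundaryTransfer D H embedEdge
  boundaryTransfer P = preimage φ P , ∣preimage∣≤∣p∣ φ φ-injective P ,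
    λ B cover v (x , z , xv , vz , ¬Bxv , Bvz) →
      ∈-preimage⁺ φ (cover (φ v) (φ x , φ z , φ-edge x v xv , φ-edge v z vz , ¬Bxv , Bvz))

module Contraction {n n′} (H : Digraph n) (x y : Fin n) (H′ : Digraph n′)
                   (con : ContractionOf H x y H′) where

  private
    σ : Fin n → Fin n′
    σ = proj₁ con

    σx≡σy : σ x ≡ σ y
    σx≡σy = proj₁ (proj₂ con)

    σ-fibre : ∀ u v → σ u ≡ σ v → u ≡ v ⊎ ((u ≡ x ⊎ u ≡ y) × (v ≡ x ⊎ v ≡ y))
    σ-fibre = proj₁ (proj₂ (proj₂ (proj₂ con)))

    edge-reflect : ∀ a b → E H′ a b ≡ true →
                   a ≢ b × Σ (Fin n) λ u → Σ (Fin n) λ v → σ u ≡ a × σ v ≡ b × E H u v ≡ true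
    edge-reflect = proj₁ (proj₂ (proj₂ (proj₂ (proj₂ con))))

  liftEdge : Edge H′ → Edge H
  liftEdge ((a , b) , ab) = let _ , u , v , _ , _ , uv = edge-reflect a b ab in (u , v) , uv

  σ-liftEdge : ∀ e → Product.map σ σ (proj₁ (liftEdge e)) ≡ proj₁ e
  σ-liftEdge ((a , b) , ab) =
    let _ , _ , _ , σu≡a , σv≡b , _ = edge-reflect a b ab in cong₂ _,_ σu≡a σv≡b

  liftEdge-injective : ∀ {e e′} → liftEdge e ≡ liftEdge e′ → e ≡ e′
  liftEdge-injective {e} {e′} eq =
    Edge-≡ H′ (trans (sym (σ-liftEdge e)) (trans (cong (Product.map σ σ ∘ proj₁) eq) (σ-liftEdge e′)))

  module _ (xy : E H x y ≡ true) (y-indeg≤1 : indeg H y ≤ 1)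
           {B : Edge H → Set} {P : Subset n} (cover : ∀ v → SV H B v → v ∈ P) where

    private
      σ-boundary : ∀ {u v v₂ w} (uv : E H u v ≡ true) (v₂w : E H v₂ w ≡ true) →
                   ¬ B ((u , v) , uv) → B ((v₂ , w) , v₂w) → σ u ≢ σ v → σ v ≡ σ v₂ →
                   σ v ∈ image σ P
      σ-boundary {u} {v} {v₂} {w} uv v₂w ¬Buv Bv₂w σu≢σv σv≡σv₂ with σ-fibre v v₂ σv≡σv₂
      ... | inj₁ refl                    = ∈-image⁺ σ P (cover v (u , w , uv , v₂w , ¬Buv , Bv₂w))
      ... | inj₂ (inj₁ refl , inj₁ refl) = ∈-image⁺ σ P (cover v (u , w , uv , v₂w , ¬Buv , Bv₂w))
      ... | inj₂ (inj₂ refl , inj₂ refl) = ∈-image⁺ σ P (cover v (u , w , uv , v₂w , ¬Buv , Bv₂w))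
      ... | inj₂ (inj₂ refl , inj₁ refl) =
        contradiction (trans (cong σ (countTrue≤1⇒unique (λ t → E H t y) y-indeg≤1 uv xy)) σx≡σy)
                      σu≢σv
      -- the edge xy puts x or y into S_B^V, whichever side of B it lies on
      ... | inj₂ (inj₁ refl , inj₂ refl) with x ∈? P | y ∈? P
      ...   | yes x∈P | _       = ∈-image⁺ σ P x∈P
      ...   | no _    | yes y∈P = subst (_∈ image σ P) (sym σx≡σy) (∈-image⁺ σ P y∈P)
      ...   | no x∉P  | no y∉P  = contradiction (cover y (x , w , xy , v₂w , ¬Bxy , Bv₂w)) y∉P
        where
        ¬Bxy : ¬ B ((x , y) , xy)
        ¬Bxy Bxy = x∉P (cover x (u , y , uv , xy , ¬Buv , Bxy))

    liftEdge-boundary : ∀ {v′} → SV H′ (B ∘ liftEdge) v′ → v′ ∈ image σ P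
    liftEdge-boundary {v′} (a , b , av′ , v′b , ¬Bav′ , Bv′b) =
      let a≢v′ , _ , _ , σu≡a , σv≡v′ , _ = edge-reflect a v′ av′
          _    , _ , _ , σv₂≡v′ , _ , _ = edge-reflect v′ b v′b
      in subst (_∈ image σ P) σv≡v′
           (σ-boundary _ _ ¬Bav′ Bv′b (λ eq → a≢v′ (trans (sym σu≡a) (trans eq σv≡v′)))
                       (trans σv≡v′ (sym σv₂≡v′)))

  boundaryTransfer : E H x y ≡ true → indeg H y ≤ 1 → BoundaryTransfer H H′ liftEdge
  boundaryTransfer xy y-indeg≤1 P =
    image σ P , ∣image∣≤∣p∣ σ P , λ B cover v′ → liftEdge-boundary xy y-indeg≤1 cover

mainTheorem5 : ∀ {n m} (D : Digraph n) (H : Digraph m) → ButterflyMinor D H →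
                 ∀ (k : ℕ) → DbwAtMost D k → DbwAtMost H k
mainTheorem5 D H (subgraph sub) =
  dbw-pullback embedEdge embedEdge-injective boundaryTransfer
  where open Subgraph D H sub
mainTheorem5 D H′ (contract {H = H} x y minor (xy , _ , y-indeg≡1) con) k =
  dbw-pullback liftEdge liftEdge-injective (boundaryTransfer xy (≤-reflexive y-indeg≡1)) k
  ∘ mainTheorem5 D H minor k
  where open Contraction H x y H′ con
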